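{- Let $r,s$ be positive integers, let $k=2^{8}r^{2}$, and let $c\ge 8rs\binom{k}{r}$. Let $M$ be an $n\times n$ zero-one matrix such that $k$ divides $n$ and $w(M)\ge cn^{\frac{3}{2}}$. Then either (i) $M$ contains an $\frac{n}{k}\times\frac{n}{k}$ zero-one matrix $N$ with $w(N)\ge 2c\left(\frac{n}{k}\right)^{\frac{3}{2}}$, or (ii) for some positive integer $m$, $M$ contains an $\frac{nr}{k}\times m$ zero-one matrix $N$ which is $r$-balanced and satisfies $w(N)\ge rs\sqrt{m}\left(\frac{nr}{k}\right)$.
   Context: $w(M)$ is the number of $1$-entries of $M$. A zero-one matrix $M$ contains a zero-one matrix $N$ if one can delete some rows and columns of $M$ and turn some $1$-entries into $0$-entries so that the result is $N$. An $a\times m$ zero-one matrix $N$ is $r$-balanced if $r$ divides $a$ and for every column $c\in[m]$, the number of $1$-entries among $N((i-1)\frac{a}{r}+1,c),\dots,N(i\frac{a}{r},c)$ is the same for all $i\in[r]$.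
   Formalization: The constant c is taken to be a nonnegative rational. -}

module Defs where

open import Data.Nat using (ℕ; zero; suc; _+_; _*_)
open import Data.Bool using (Bool; true; false)
open import Data.Fin using (Fin; zero; suc; combine; cast) renaming (_<_ to _<ᶠ_)
open import Data.Product using (Σ; Σ-syntax; _×_)
open import Relation.Binary.PropositionalEquality using (_≡_; sym)

Matrix : ℕ → ℕ → Set
Matrix a b = Fin a → Fin b → Bool

Σ< : (n : ℕ) → (Fin n → ℕ) → ℕ
Σ< zero    f = 0
Σ< (suc n) f = f zero + Σ< n (λ i → f (suc i))

bit : Bool → ℕ
bit true  = 1
bit false = 0

w : {a b : ℕ} → Matrix a b → ℕ
w {a} {b} M = Σ< a (λ i → Σ< b (λ j → bit (M i j)))

StrictlyIncreasing : {a n : ℕ} → (Fin a → Fin n) → Set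
StrictlyIncreasing f = ∀ i j → i <ᶠ j → f i <ᶠ f j

-- M contains N: delete rows/columns of M (i.e. choose increasing row/column
-- indices) and turn some 1-entries into 0-entries to obtain N.
Contains : {n₁ n₂ a b : ℕ} → Matrix n₁ n₂ → Matrix a b → Set
Contains {n₁} {n₂} {a} {b} M N =
  Σ[ f ∈ (Fin a → Fin n₁) ] Σ[ g ∈ (Fin b → Fin n₂) ]
    (StrictlyIncreasing f × StrictlyIncreasing g ×
     (∀ i j → N i j ≡ true → M (f i) (g j) ≡ true))

-- r-balanced: r ∣ a (a = r * t), and for each column c, the number of 1-entries
-- in the i-th block of t consecutive rows (rows (i-1)t+1..it, i.e. 0-based rows
-- i*t + l for l < t, which is 'combine i l') is the same for all i.
Balanced : (r : ℕ) {a m : ℕ} → Matrix a m → Set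
Balanced r {a} {m} N =
  Σ[ t ∈ ℕ ] Σ[ e ∈ r * t ≡ a ]
    (∀ (c : Fin m) (i j : Fin r) →
       Σ< t (λ l → bit (N (cast e (combine i l)) c))
       ≡ Σ< t (λ l → bit (N (cast e (combine j l)) c)))

module Submission where

-- The proof follows the paper's counting argument, with every square root
-- squared away and the density c = p/q multiplied through by q.
--
-- Write n = k·t with k = (16r)² and cut the rows of M into k blocks of t rows.
-- For a block I and a column c let d(I,c) be the number of 1-entries of column c
-- inside block I, and call (I,c) big when d(I,c) ≥ 2c√t.
--  (1) Choosing t columns of a block, big ones first, either gives a t × t
--      submatrix of weight ≥ 2c·t^{3/2}, which is outcome (i), or shows that
--      the big entries of the block weigh less than 2c·t^{3/2}.
--  (2) If this happens in every block, the small entries y(I,c) carry almost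
--      all of w(M).  A layer-cake count bounds Σ_I y(I,c) by
--      k·Σ_S min_{I∈S} y(I,c) + (r-1)·max_I y(I,c), summing over the r-subsets
--      S of blocks, and averaging over the (k choose r) subsets yields one
--      subset S whose weight V = Σ_c min_{I∈S} y(I,c) is large.
--  (3) Keeping, in every block of S and every column c, exactly
--      min_{I∈S} y(I,c) of its ones gives an r-balanced (r·t) × n submatrix of
--      weight r·V, which is outcome (ii).

open import Defs
open import Data.Nat using (ℕ; suc; _+_; _*_; _^_; _≤_)
open import Data.Nat.Combinatorics using (_C_)
open import Data.Product using (Σ; Σ-syntax; _×_)
open import Data.Sum using (_⊎_)
open import Relation.Binary.PropositionalEquality using (_≡_)

open import Data.Bool using (Bool; true; false; T)
open import Data.Unit using (tt)
open import Data.Empty using (⊥)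
open import Data.Fin using (Fin; zero; suc; combine; remQuot; toℕ; cast; _↑ˡ_; _↑ʳ_)
  renaming (_<_ to _<ᶠ_)
open import Data.Fin.Properties
  using (toℕ-combine; combine-monoˡ-<; combine-remQuot; remQuot-combine; cast-is-id) renaming (<-cmp to <ᶠ-cmp)
open import Data.List using (List; []; _∷_; _++_; length; map)
open import Data.List.Properties using (length-++; length-map; map-++; map-cong; map-∘)
open import Data.List.Relation.Unary.All using (All; []; _∷_)
open import Data.Nat using (zero; _∸_; _⊓_; _⊔_; _<_; _<ᵇ_; _≤ᵇ_; z≤n; s≤s)
open import Data.Nat.Combinatorics using (nCk+nC[k+1]≡[n+1]C[k+1])
open import Data.Nat.ListAction using (sum)
open import Data.Nat.ListAction.Properties using (sum-++)
open import Data.Nat.Properties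
open import Data.List.Extrema ≤-totalOrder using (argmax; f[xs]≤f[argmax])
open import Data.Nat.Tactic.RingSolver using (solve-∀)
open import Data.Product using (_,_; proj₁; proj₂)
open import Data.Sum using (inj₁; inj₂; map₂)
open import Function using (_∘_)
open import Relation.Binary.Definitions using (tri<; tri≈; tri>)
open import Relation.Binary.PropositionalEquality
  using (refl; sym; trans; cong; cong₂; subst; subst₂; module ≡-Reasoning)
open import Relation.Nullary using (Dec; yes; no; contradiction)
open import Relation.Nullary.Reflects using (ofʸ; ofⁿ)

infix 4 _≤_√_ _√_≤_

_≤_√_ : ℕ → ℕ → ℕ → Set
x ≤ l √ T = x * x ≤ l * l * T

_√_≤_ : ℕ → ℕ → ℕ → Set
l √ T ≤ x = l * l * T ≤ x * x

sqrt-mono : ∀ {x y} → x * x ≤ y * y → x ≤ y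
sqrt-mono h = ≮⇒≥ (λ y<x → <⇒≱ (*-mono-< y<x y<x) h)

square-of-* : ∀ x z → (x * z) * (x * z) ≡ (x * x) * (z * z)
square-of-* = solve-∀

square-of-√* : ∀ l m T → (l * l * T) * (m * m * T) ≡ (l * m * T) * (l * m * T)
square-of-√* = solve-∀

√-*-upper : ∀ {x z l m T} → x ≤ l √ T → z ≤ m √ T → x * z ≤ l * m * T
√-*-upper {x} {z} {l} {m} {T} hx hz = sqrt-mono (begin
  (x * z) * (x * z)          ≡⟨ square-of-* x z ⟩
  (x * x) * (z * z)          ≤⟨ *-mono-≤ hx hz ⟩
  (l * l * T) * (m * m * T)  ≡⟨ square-of-√* l m T ⟩
  (l * m * T) * (l * m * T)  ∎)
  where open ≤-Reasoning

√-*-lower : ∀ {x z l m T} → l √ T ≤ x → m √ T ≤ z → l * m * T ≤ x * z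
√-*-lower {x} {z} {l} {m} {T} hx hz = sqrt-mono (begin
  (l * m * T) * (l * m * T)  ≡⟨ square-of-√* l m T ⟨
  (l * l * T) * (m * m * T)  ≤⟨ *-mono-≤ hx hz ⟩
  (x * x) * (z * z)          ≡⟨ square-of-* x z ⟨
  (x * z) * (x * z)          ∎)
  where open ≤-Reasoning

square-of-+ : ∀ x z → (x + z) * (x + z) ≡ x * x + 2 * (x * z) + z * z
square-of-+ = solve-∀

square-of-√+ : ∀ l m T → (l + m) * (l + m) * T ≡ l * l * T + 2 * (l * m * T) + m * m * T
square-of-√+ = solve-∀

√-+-upper : ∀ {x z l m T} → x ≤ l √ T → z ≤ m √ T → x + z ≤ (l + m) √ T
√-+-upper {x} {z} {l} {m} {T} hx hz = begin
  (x + z) * (x + z)                        ≡⟨ square-of-+ x z ⟩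
  x * x + 2 * (x * z) + z * z              ≤⟨ +-mono-≤ (+-mono-≤ hx (*-monoʳ-≤ 2 (√-*-upper {x} {z} {l} {m} {T} hx hz))) hz ⟩
  l * l * T + 2 * (l * m * T) + m * m * T  ≡⟨ square-of-√+ l m T ⟨
  (l + m) * (l + m) * T                    ∎
  where open ≤-Reasoning

√-+-lower : ∀ {x z l m T} → l √ T ≤ x → m √ T ≤ z → (l + m) √ T ≤ x + z
√-+-lower {x} {z} {l} {m} {T} hx hz = begin
  (l + m) * (l + m) * T                    ≡⟨ square-of-√+ l m T ⟩
  l * l * T + 2 * (l * m * T) + m * m * T  ≤⟨ +-mono-≤ (+-mono-≤ hx (*-monoʳ-≤ 2 (√-*-lower {x} {z} {l} {m} {T} hx hz))) hz ⟩
  x * x + 2 * (x * z) + z * z              ≡⟨ square-of-+ x z ⟨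
  (x + z) * (x + z)                        ∎
  where open ≤-Reasoning

√-∸ : ∀ {a x z l m T} → (l + m) √ T ≤ a → a ≤ x + z → x ≤ l √ T → m √ T ≤ z
√-∸ {a} {x} {z} {l} {m} {T} a-large a≤x+z hx = ≮⇒≥ z-not-small
  where
  open ≤-Reasoning
  z-not-small : z * z < m * m * T → ⊥
  z-not-small hz = <-irrefl refl (begin-strict
    (x + z) * (x + z)                        ≡⟨ square-of-+ x z ⟩
    x * x + 2 * (x * z) + z * z              <⟨ +-mono-≤-< (+-mono-≤ hx (*-monoʳ-≤ 2 (√-*-upper {x} {z} {l} {m} {T} hx (<⇒≤ hz)))) hz ⟩
    l * l * T + 2 * (l * m * T) + m * m * T  ≡⟨ square-of-√+ l m T ⟨
    (l + m) * (l + m) * T                    ≤⟨ a-large ⟩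
    a * a                                    ≤⟨ *-mono-≤ a≤x+z a≤x+z ⟩
    (x + z) * (x + z)                        ∎)

square-of-scaled : ∀ c l T → (c * c) * (l * l * T) ≡ (c * l) * (c * l) * T
square-of-scaled = solve-∀

√-scale : ∀ c {x l T} → x ≤ l √ T → c * x ≤ (c * l) √ T
√-scale c {x} {l} {T} h = begin
  (c * x) * (c * x)      ≡⟨ square-of-* c x ⟩
  (c * c) * (x * x)      ≤⟨ *-monoʳ-≤ (c * c) h ⟩
  (c * c) * (l * l * T)  ≡⟨ square-of-scaled c l T ⟩
  (c * l) * (c * l) * T  ∎
  where open ≤-Reasoning

√-cancel : ∀ {c z l T} → 1 ≤ c → (c * l) √ T ≤ c * z → l √ T ≤ z
√-cancel {suc c} {z} {l} {T} _ h = *-cancelˡ-≤ (suc c * suc c) (begin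
  (suc c * suc c) * (l * l * T)  ≡⟨ square-of-scaled (suc c) l T ⟩
  (suc c * l) * (suc c * l) * T  ≤⟨ h ⟩
  (suc c * z) * (suc c * z)      ≡⟨ square-of-* (suc c) z ⟩
  (suc c * suc c) * (z * z)      ∎)
  where open ≤-Reasoning

√-weaken : ∀ {l l' x x' T} → l ≤ l' → x ≤ x' → l' √ T ≤ x → l √ T ≤ x'
√-weaken {T = T} l≤l' x≤x' h =
  ≤-trans (*-monoˡ-≤ T (*-mono-≤ l≤l' l≤l')) (≤-trans h (*-mono-≤ x≤x' x≤x'))

Σ<-cong : ∀ n {f g : Fin n → ℕ} → (∀ i → f i ≡ g i) → Σ< n f ≡ Σ< n g
Σ<-cong zero    h = refl
Σ<-cong (suc n) h = cong₂ _+_ (h zero) (Σ<-cong n (h ∘ suc))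

Σ<-mono : ∀ n {f g : Fin n → ℕ} → (∀ i → f i ≤ g i) → Σ< n f ≤ Σ< n g
Σ<-mono zero    h = z≤n
Σ<-mono (suc n) h = +-mono-≤ (h zero) (Σ<-mono n (h ∘ suc))

Σ<-const : ∀ n c → Σ< n (λ _ → c) ≡ n * c
Σ<-const zero    c = refl
Σ<-const (suc n) c = cong (c +_) (Σ<-const n c)

Σ<-+ : ∀ n (f g : Fin n → ℕ) → Σ< n (λ i → f i + g i) ≡ Σ< n f + Σ< n g
Σ<-+ zero    f g = refl
Σ<-+ (suc n) f g = begin
  (f zero + g zero) + Σ< n (λ i → f (suc i) + g (suc i))
    ≡⟨ cong (f zero + g zero +_) (Σ<-+ n (f ∘ suc) (g ∘ suc)) ⟩
  (f zero + g zero) + (Σ< n (f ∘ suc) + Σ< n (g ∘ suc))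
    ≡⟨ +-transpose (f zero) (g zero) _ _ ⟩
  (f zero + Σ< n (f ∘ suc)) + (g zero + Σ< n (g ∘ suc)) ∎
  where
  open ≡-Reasoning
  +-transpose : ∀ a b c d → (a + b) + (c + d) ≡ (a + c) + (b + d)
  +-transpose = solve-∀

Σ<-*ˡ : ∀ n c (f : Fin n → ℕ) → c * Σ< n f ≡ Σ< n (λ i → c * f i)
Σ<-*ˡ zero    c f = *-zeroʳ c
Σ<-*ˡ (suc n) c f = trans (*-distribˡ-+ c (f zero) _) (cong (c * f zero +_) (Σ<-*ˡ n c (f ∘ suc)))

Σ<-swap : ∀ a b (f : Fin a → Fin b → ℕ) →
  Σ< a (λ i → Σ< b (f i)) ≡ Σ< b (λ j → Σ< a (λ i → f i j))
Σ<-swap zero    b f = sym (trans (Σ<-const b 0) (*-zeroʳ b))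
Σ<-swap (suc a) b f = trans (cong (Σ< b (f zero) +_) (Σ<-swap a b (f ∘ suc)))
                           (sym (Σ<-+ b (f zero) (λ j → Σ< a (λ i → f (suc i) j))))

Σ<-++ : ∀ a b (f : Fin (a + b) → ℕ) → Σ< (a + b) f ≡ Σ< a (λ i → f (i ↑ˡ b)) + Σ< b (λ j → f (a ↑ʳ j))
Σ<-++ zero    b f = refl
Σ<-++ (suc a) b f = trans (cong (f zero +_) (Σ<-++ a b (f ∘ suc))) (sym (+-assoc (f zero) _ _))

Σ<-combine : ∀ a b (f : Fin (a * b) → ℕ) → Σ< (a * b) f ≡ Σ< a (λ i → Σ< b (λ j → f (combine i j)))
Σ<-combine zero    b f = refl
Σ<-combine (suc a) b f =
  trans (Σ<-++ b (a * b) f) (cong (Σ< b (λ j → f (j ↑ˡ (a * b))) +_) (Σ<-combine a b (λ x → f (b ↑ʳ x))))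

Σ<-√-upper : ∀ n {l T} (a : Fin n → ℕ) → (∀ i → a i ≤ l √ T) → Σ< n a ≤ (n * l) √ T
Σ<-√-upper zero    a h = z≤n
Σ<-√-upper (suc n) {l} {T} a h =
  √-+-upper {a zero} {Σ< n (a ∘ suc)} {l} {n * l} {T} (h zero) (Σ<-√-upper n (a ∘ suc) (h ∘ suc))

Σ<-√-lower : ∀ n {l T} (a : Fin n → ℕ) → (∀ i → l √ T ≤ a i) → (n * l) √ T ≤ Σ< n a
Σ<-√-lower zero    a h = z≤n
Σ<-√-lower (suc n) {l} {T} a h =
  √-+-lower {a zero} {Σ< n (a ∘ suc)} {l} {n * l} {T} (h zero) (Σ<-√-lower n (a ∘ suc) (h ∘ suc))

Subset : ℕ → ℕ → Set
Subset k r = Σ (Fin r → Fin k) StrictlyIncreasing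

with-zero : ∀ {k r} → Subset k r → Subset (suc k) (suc r)
with-zero {k} {r} (f , f-inc) = g , g-inc
  where
  g : Fin (suc r) → Fin (suc k)
  g zero    = zero
  g (suc i) = suc (f i)
  g-inc : StrictlyIncreasing g
  g-inc zero    zero    ()
  g-inc zero    (suc j) _       = s≤s z≤n
  g-inc (suc i) zero    ()
  g-inc (suc i) (suc j) (s≤s h) = s≤s (f-inc i j h)

without-zero : ∀ {k r} → Subset k r → Subset (suc k) r
without-zero (f , f-inc) = suc ∘ f , λ i j h → s≤s (f-inc i j h)

subsets : (k r : ℕ) → List (Subset k r)
subsets k       zero    = ((λ ()) , (λ ())) ∷ []
subsets zero    (suc r) = []
subsets (suc k) (suc r) = map with-zero (subsets k r) ++ map without-zero (subsets k (suc r))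

length-subsets : ∀ k r → length (subsets k r) ≡ k C r
length-subsets k       zero    = refl
length-subsets zero    (suc r) = refl
length-subsets (suc k) (suc r) = begin
  length (map with-zero (subsets k r) ++ map without-zero (subsets k (suc r)))
    ≡⟨ length-++ (map with-zero (subsets k r)) ⟩
  length (map with-zero (subsets k r)) + length (map without-zero (subsets k (suc r)))
    ≡⟨ cong₂ _+_ (length-map with-zero (subsets k r)) (length-map without-zero (subsets k (suc r))) ⟩
  length (subsets k r) + length (subsets k (suc r))
    ≡⟨ cong₂ _+_ (length-subsets k r) (length-subsets k (suc r)) ⟩
  k C r + k C suc r
    ≡⟨ nCk+nC[k+1]≡[n+1]C[k+1] k r ⟩
  suc k C suc r ∎
  where open ≡-Reasoning

subsets-nonempty : ∀ {k r} → r ≤ k → 1 ≤ length (subsets k r)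
subsets-nonempty {k}     {zero}  _         = s≤s z≤n
subsets-nonempty {suc k} {suc r} (s≤s r≤k) = begin
  1                                     ≤⟨ subsets-nonempty r≤k ⟩
  length (subsets k r)                  ≡⟨ length-map with-zero (subsets k r) ⟨
  length (map with-zero (subsets k r))  ≤⟨ m≤m+n _ _ ⟩
  length (map with-zero (subsets k r)) + length (map without-zero (subsets k (suc r)))
                                        ≡⟨ length-++ (map with-zero (subsets k r)) ⟨
  length (subsets (suc k) (suc r))      ∎
  where open ≤-Reasoning

sum-map-mono : ∀ {A : Set} {f g : A → ℕ} (L : List A) → (∀ x → f x ≤ g x) → sum (map f L) ≤ sum (map g L)
sum-map-mono []      h = z≤n
sum-map-mono (x ∷ L) h = +-mono-≤ (h x) (sum-map-mono L h)

averaging : ∀ {A : Set} (f : A → ℕ) (L : List A) → 1 ≤ length L →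
  Σ[ S ∈ A ] sum (map f L) ≤ length L * f S
averaging {A} f (a ∷ L) _ = best , bounded-sum (a ∷ L) (f[xs]≤f[argmax] {f = f} a (a ∷ L))
  where
  best : A
  best = argmax f a (a ∷ L)
  bounded-sum : (L : List A) → All (λ x → f x ≤ f best) L → sum (map f L) ≤ length L * f best
  bounded-sum []      []       = z≤n
  bounded-sum (x ∷ L) (h ∷ hs) = +-mono-≤ h (bounded-sum L hs)

Σ<-sum-swap : ∀ n {A : Set} (h : Fin n → A → ℕ) (L : List A) →
  Σ< n (λ c → sum (map (h c) L)) ≡ sum (map (λ S → Σ< n (λ c → h c S)) L)
Σ<-sum-swap n h []      = trans (Σ<-const n 0) (*-zeroʳ n)
Σ<-sum-swap n h (x ∷ L) = trans (Σ<-+ n (λ c → h c x) (λ c → sum (map (h c) L)))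
                                (cong (Σ< n (λ c → h c x) +_) (Σ<-sum-swap n h L))

minOn : ∀ {k r} → (Fin r → Fin k) → (Fin k → ℕ) → ℕ → ℕ
minOn {r = zero}  f y b = b
minOn {r = suc r} f y b = y (f zero) ⊓ minOn (f ∘ suc) y b

minOn≤cap : ∀ {k r} (f : Fin r → Fin k) y b → minOn f y b ≤ b
minOn≤cap {r = zero}  f y b = ≤-refl
minOn≤cap {r = suc r} f y b = ≤-trans (m⊓n≤n _ _) (minOn≤cap (f ∘ suc) y b)

minOn≤member : ∀ {k r} (f : Fin r → Fin k) y b i → minOn f y b ≤ y (f i)
minOn≤member {r = suc r} f y b zero    = m⊓n≤m _ _
minOn≤member {r = suc r} f y b (suc i) = ≤-trans (m⊓n≤n _ _) (minOn≤member (f ∘ suc) y b i)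

minOn-mono : ∀ {k r} (f : Fin r → Fin k) y {b c} → b ≤ c → minOn f y b ≤ minOn f y c
minOn-mono {r = zero}  f y b≤c = b≤c
minOn-mono {r = suc r} f y b≤c = ⊓-monoʳ-≤ _ (minOn-mono (f ∘ suc) y b≤c)

minOn-shift : ∀ {k r} (f : Fin r → Fin k) y b → minOn (suc ∘ f) y b ≡ minOn f (y ∘ suc) b
minOn-shift {r = zero}  f y b = refl
minOn-shift {r = suc r} f y b = cong (y (suc (f zero)) ⊓_) (minOn-shift (f ∘ suc) y b)

subsetMinSum : ∀ k r → (Fin k → ℕ) → ℕ → ℕ
subsetMinSum k r y b = sum (map (λ S → minOn (proj₁ S) y b) (subsets k r))

subsetMinSum-mono : ∀ k r y {b c} → b ≤ c → subsetMinSum k r y b ≤ subsetMinSum k r y c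
subsetMinSum-mono k r y b≤c = sum-map-mono (subsets k r) (λ S → minOn-mono (proj₁ S) y b≤c)

subsetMinSum-split : ∀ k r y b → subsetMinSum (suc k) (suc r) y b ≡
  sum (map (λ S → y zero ⊓ minOn (proj₁ S) (y ∘ suc) b) (subsets k r)) + subsetMinSum k (suc r) (y ∘ suc) b
subsetMinSum-split k r y b = begin
  sum (map F (map with-zero L ++ map without-zero L'))
    ≡⟨ cong sum (map-++ F (map with-zero L) (map without-zero L')) ⟩
  sum (map F (map with-zero L) ++ map F (map without-zero L'))
    ≡⟨ sum-++ (map F (map with-zero L)) (map F (map without-zero L')) ⟩
  sum (map F (map with-zero L)) + sum (map F (map without-zero L'))
    ≡⟨ cong₂ _+_ (cong sum (sym (map-∘ L))) (cong sum (sym (map-∘ L'))) ⟩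
  sum (map (F ∘ with-zero) L) + sum (map (F ∘ without-zero) L')
    ≡⟨ cong₂ _+_ (cong sum (map-cong (λ S → cong (y zero ⊓_) (minOn-shift (proj₁ S) y b)) L))
                 (cong sum (map-cong (λ S → minOn-shift (proj₁ S) y b) L')) ⟩
  sum (map (λ S → y zero ⊓ minOn (proj₁ S) (y ∘ suc) b) L) + subsetMinSum k (suc r) (y ∘ suc) b ∎
  where
  open ≡-Reasoning
  L = subsets k r
  L' = subsets k (suc r)
  F : Subset (suc k) (suc r) → ℕ
  F S = minOn (proj₁ S) y b

subsetMinSum-under : ∀ k r y {v b} → b ≤ v →
  sum (map (λ S → v ⊓ minOn (proj₁ S) y b) (subsets k r)) ≡ subsetMinSum k r y b
subsetMinSum-under k r y b≤v =
  cong sum (map-cong (λ S → m≥n⇒m⊓n≡n (≤-trans (minOn≤cap (proj₁ S) y _) b≤v)) (subsets k r))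

countAbove : ∀ k → (Fin k → ℕ) → ℕ → ℕ
countAbove k y b = Σ< k (λ I → bit (b <ᵇ y I))

countAbove≤k : ∀ k y b → countAbove k y b ≤ k
countAbove≤k k y b = begin
  countAbove k y b       ≤⟨ Σ<-mono k (λ I → bit≤1 (b <ᵇ y I)) ⟩
  Σ< k (λ _ → 1)         ≡⟨ Σ<-const k 1 ⟩
  k * 1                  ≡⟨ *-identityʳ k ⟩
  k                      ∎
  where
  open ≤-Reasoning
  bit≤1 : ∀ x → bit x ≤ 1
  bit≤1 true  = ≤-refl
  bit≤1 false = z≤n

-- If at least r values exceed b, then some r-subset lies entirely above b, so
-- raising the cap from b to b + 1 raises the subset sum.
subsetMinSum-step : ∀ k r y b → r ≤ countAbove k y b → suc (subsetMinSum k r y b) ≤ subsetMinSum k r y (suc b)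
subsetMinSum-step k       zero    y b _  = ≤-refl
subsetMinSum-step zero    (suc r) y b ()
subsetMinSum-step (suc k) (suc r) y b r<count
  rewrite subsetMinSum-split k r y b | subsetMinSum-split k r y (suc b)
  with b <ᵇ y zero | <ᵇ-reflects-< b (y zero)
... | true  | ofʸ b<y₀ =
  +-mono-≤ (subst₂ (λ x z → suc x ≤ z) (sym (subsetMinSum-under k r (y ∘ suc) (<⇒≤ b<y₀)))
                                       (sym (subsetMinSum-under k r (y ∘ suc) b<y₀))
                                       (subsetMinSum-step k r (y ∘ suc) b (≤-pred r<count)))
           (subsetMinSum-mono k (suc r) (y ∘ suc) (n≤1+n b))
... | false | ofⁿ _ =
  ≤-trans (≤-reflexive (sym (+-suc _ _)))
          (+-mono-≤ (sum-map-mono (subsets k r) (λ S → ⊓-monoʳ-≤ (y zero) (minOn-mono (proj₁ S) (y ∘ suc) (n≤1+n b))))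
                    (subsetMinSum-step k (suc r) (y ∘ suc) b r<count))

⊓-suc : ∀ y b → y ⊓ suc b ≡ y ⊓ b + bit (b <ᵇ y)
⊓-suc zero    b       = refl
⊓-suc (suc y) zero    = cong suc (⊓-zeroʳ y)
⊓-suc (suc y) (suc b) = cong suc (⊓-suc y b)

-- The level j < b contributes countAbove k y j on the left; this is at most k,
-- and an r-subset then lies above j, unless it is at most r'.
layer-cake : ∀ k r' y b → Σ< k (λ I → y I ⊓ b) ≤ k * subsetMinSum k (suc r') y b + r' * b
layer-cake k r' y zero = ≤-trans (≤-reflexive all-zero) z≤n
  where
  all-zero : Σ< k (λ I → y I ⊓ 0) ≡ 0
  all-zero = trans (Σ<-cong k (λ I → ⊓-zeroʳ (y I))) (trans (Σ<-const k 0) (*-zeroʳ k))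
layer-cake k r' y (suc b) = begin
  Σ< k (λ I → y I ⊓ suc b)                    ≡⟨ Σ<-cong k (λ I → ⊓-suc (y I) b) ⟩
  Σ< k (λ I → y I ⊓ b + bit (b <ᵇ y I))       ≡⟨ Σ<-+ k _ _ ⟩
  Σ< k (λ I → y I ⊓ b) + count                ≤⟨ +-monoˡ-≤ count (layer-cake k r' y b) ⟩
  k * G b + r' * b + count                    ≤⟨ one-level (suc r' ≤? count) ⟩
  k * G (suc b) + r' * suc b                  ∎
  where
  open ≤-Reasoning
  G = subsetMinSum k (suc r') y
  count = countAbove k y b
  one-level : Dec (suc r' ≤ count) → k * G b + r' * b + count ≤ k * G (suc b) + r' * suc b
  one-level (yes r≤count) = begin
    k * G b + r' * b + count    ≡⟨ +-assoc (k * G b) (r' * b) count ⟩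
    k * G b + (r' * b + count)  ≡⟨ cong (k * G b +_) (+-comm (r' * b) count) ⟩
    k * G b + (count + r' * b)  ≡⟨ +-assoc (k * G b) count (r' * b) ⟨
    k * G b + count + r' * b    ≤⟨ +-mono-≤ (+-monoʳ-≤ (k * G b) (countAbove≤k k y b)) (*-monoʳ-≤ r' (n≤1+n b)) ⟩
    k * G b + k + r' * suc b    ≡⟨ cong (_+ r' * suc b) (trans (+-comm (k * G b) k) (sym (*-suc k (G b)))) ⟩
    k * suc (G b) + r' * suc b  ≤⟨ +-monoˡ-≤ (r' * suc b) (*-monoʳ-≤ k (subsetMinSum-step k (suc r') y b r≤count)) ⟩
    k * G (suc b) + r' * suc b  ∎
  one-level (no r≰count) = begin
    k * G b + r' * b + count    ≡⟨ +-assoc (k * G b) (r' * b) count ⟩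
    k * G b + (r' * b + count)  ≤⟨ +-mono-≤ (*-monoʳ-≤ k (subsetMinSum-mono k (suc r') y (n≤1+n b)))
                                            (+-monoʳ-≤ (r' * b) (≤-pred (≰⇒> r≰count))) ⟩
    k * G (suc b) + (r' * b + r') ≡⟨ cong (k * G (suc b) +_) (trans (+-comm (r' * b) r') (sym (*-suc r' b))) ⟩
    k * G (suc b) + r' * suc b  ∎

keepIf : Bool → ℕ → ℕ
keepIf true  v = v
keepIf false v = 0

dropIf : Bool → ℕ → ℕ
dropIf true  v = 0
dropIf false v = v

keepIf+dropIf : ∀ b v → keepIf b v + dropIf b v ≡ v
keepIf+dropIf true  v = +-identityʳ v
keepIf+dropIf false v = refl

keepIf≤ : ∀ b v → keepIf b v ≤ v
keepIf≤ true  v = ≤-refl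
keepIf≤ false v = z≤n

dropIf≤ : ∀ b v → dropIf b v ≤ v
dropIf≤ true  v = z≤n
dropIf≤ false v = ≤-refl

select : ∀ n t → t ≤ n → (P : Fin n → Bool) (x : Fin n → ℕ) →
  Σ[ S ∈ Subset n t ] ((∀ j → P (proj₁ S j) ≡ true)
                      ⊎ Σ< n (λ c → keepIf (P c) (x c)) ≤ Σ< t (x ∘ proj₁ S))
select zero    zero    _ P x = ((λ ()) , (λ ())) , inj₂ z≤n
select (suc n) zero    _ P x = ((λ ()) , (λ ())) , inj₁ (λ ())
select (suc n) (suc t) (s≤s t≤n) P x with P zero in P₀
... | true with select n t t≤n (P ∘ suc) (x ∘ suc)
...   | S , inj₁ all-marked = with-zero S , inj₁ (λ { zero → P₀ ; (suc j) → all-marked j })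
...   | S , inj₂ heavy      = with-zero S , inj₂ (+-monoʳ-≤ (x zero) heavy)
select (suc n) (suc t) (s≤s t≤n) P x | false with suc t ≤? n
... | yes t<n with select n (suc t) t<n (P ∘ suc) (x ∘ suc)
...   | S , inj₁ all-marked = without-zero S , inj₁ all-marked
...   | S , inj₂ heavy      = without-zero S , inj₂ heavy
select (suc n) (suc t) (s≤s t≤n) P x | false | no t≮n with ≤-antisym t≤n (≤-pred (≰⇒> t≮n))
... | refl = all-columns , inj₂ (≤-trans (Σ<-mono n (λ c → keepIf≤ (P (suc c)) (x (suc c)))) (m≤n+m _ (x zero)))
  where
  all-columns : Subset (suc n) (suc n)
  all-columns = (λ j → j) , (λ _ _ h → h)

-- truncate v e keeps the first e ones of the 0/1 vector v.
truncate : ∀ {t} → (Fin t → Bool) → ℕ → Fin t → Bool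
truncate v zero    l       = false
truncate v (suc e) zero    = v zero
truncate v (suc e) (suc l) = truncate (v ∘ suc) (suc e ∸ bit (v zero)) l

truncate-count : ∀ t (v : Fin t → Bool) e → Σ< t (bit ∘ truncate v e) ≡ e ⊓ Σ< t (bit ∘ v)
truncate-count zero    v e       = sym (⊓-zeroʳ e)
truncate-count (suc t) v zero    = trans (Σ<-const (suc t) 0) (*-zeroʳ (suc t))
truncate-count (suc t) v (suc e) with v zero
... | true  = cong suc (truncate-count t (v ∘ suc) e)
... | false = truncate-count t (v ∘ suc) (suc e)

truncate-⊆ : ∀ {t} (v : Fin t → Bool) e l → truncate v e l ≡ true → v l ≡ true
truncate-⊆ v (suc e) zero    h = h
truncate-⊆ v (suc e) (suc l) h = truncate-⊆ (v ∘ suc) (suc e ∸ bit (v zero)) l h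

-- Rows of a (k·t)-row matrix are grouped into k blocks of t rows; combine I l is
-- row l of block I.
combine-monoʳ-< : ∀ {k t} (I : Fin k) → StrictlyIncreasing (combine {k} {t} I)
combine-monoʳ-< {k} {t} I l l' l<l' rewrite toℕ-combine I l | toℕ-combine I l' = +-monoʳ-< (t * toℕ I) l<l'

combine-lex : ∀ {k t} (i i' : Fin k) (l l' : Fin t) →
  combine i l <ᶠ combine i' l' → (i <ᶠ i') ⊎ (i ≡ i' × l <ᶠ l')
combine-lex {k} {t} i i' l l' h with <ᶠ-cmp i i'
... | tri< i<i' _ _ = inj₁ i<i'
... | tri≈ _ refl _ = inj₂ (refl , +-cancelˡ-< (t * toℕ i) (toℕ l) (toℕ l')
                                     (subst₂ _<_ (toℕ-combine i l) (toℕ-combine i l') h))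
... | tri> _ _ i>i' = inj₁ (contradiction h (<-asym (combine-monoˡ-< l' l i>i')))

blockRows : ∀ {r k} t → (Fin r → Fin k) → Fin (r * t) → Fin (k * t)
blockRows {r} t f x = combine (f (proj₁ (remQuot {r} t x))) (proj₂ (remQuot {r} t x))

blockRows-increasing : ∀ {r k} t (f : Fin r → Fin k) → StrictlyIncreasing f → StrictlyIncreasing (blockRows t f)
blockRows-increasing {r} t f f-inc x x' x<x' =
  on-pairs _ _ _ _ (subst₂ _<ᶠ_ (sym (combine-remQuot {r} t x)) (sym (combine-remQuot {r} t x')) x<x')
  where
  on-pairs : ∀ i i' (l l' : Fin t) → combine i l <ᶠ combine i' l' → combine (f i) l <ᶠ combine (f i') l'
  on-pairs i i' l l' h with combine-lex i i' l l' h
  ... | inj₁ i<i'          = combine-monoˡ-< l l' (f-inc i i' i<i')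
  ... | inj₂ (refl , l<l') = combine-monoʳ-< (f i) l l' l<l'

blockCount : ∀ {k t m} → Matrix (k * t) m → Fin k → Fin m → ℕ
blockCount {t = t} M I c = Σ< t (λ l → bit (M (combine I l) c))

w-by-blocks : ∀ {k t m} (M : Matrix (k * t) m) → w M ≡ Σ< k (λ I → Σ< m (blockCount M I))
w-by-blocks {k} {t} {m} M =
  trans (Σ<-combine k t _) (Σ<-cong k (λ I → Σ<-swap t m (λ l c → bit (M (combine I l) c))))

balanced-submatrix : ∀ {k t m r} (M : Matrix (k * t) m) (S : Subset k r) (e : Fin m → ℕ) →
  (∀ i c → e c ≤ blockCount M (proj₁ S i) c) →
  Σ[ N ∈ Matrix (r * t) m ] (Contains M N × Balanced r N × w N ≡ r * Σ< m e)
balanced-submatrix {k} {t} {m} {r} M (f , f-inc) e enough = N , contained , balanced , weight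
  where
  column : Fin r → Fin m → Fin t → Bool
  column i c l = M (combine (f i) l) c
  N : Matrix (r * t) m
  N x c = truncate (column (proj₁ (remQuot {r} t x)) c) (e c) (proj₂ (remQuot {r} t x))
  contained : Contains M N
  contained = blockRows t f , (λ c → c) , blockRows-increasing t f f-inc , (λ _ _ h → h) ,
              λ x c → truncate-⊆ (column (proj₁ (remQuot {r} t x)) c) (e c) (proj₂ (remQuot {r} t x))
  count-in-block : ∀ i c → blockCount N i c ≡ e c
  count-in-block i c = begin
    Σ< t (λ l → bit (N (combine i l) c))
      ≡⟨ Σ<-cong t (λ l → cong (λ (i' , l') → bit (truncate (column i' c) (e c) l')) (remQuot-combine {r} i l)) ⟩
    Σ< t (bit ∘ truncate (column i c) (e c))
      ≡⟨ truncate-count t (column i c) (e c) ⟩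
    e c ⊓ blockCount M (f i) c
      ≡⟨ m≤n⇒m⊓n≡m (enough i c) ⟩
    e c ∎
    where open ≡-Reasoning
  count-in-cast-block : ∀ i c → Σ< t (λ l → bit (N (cast refl (combine i l)) c)) ≡ e c
  count-in-cast-block i c =
    trans (Σ<-cong t (λ l → cong (λ x → bit (N x c)) (cast-is-id refl (combine i l)))) (count-in-block i c)
  balanced : Balanced r N
  balanced = t , refl , λ c i j → trans (count-in-cast-block i c) (sym (count-in-cast-block j c))
  weight : w N ≡ r * Σ< m e
  weight = begin
    w N                                  ≡⟨ w-by-blocks {r} N ⟩
    Σ< r (λ i → Σ< m (blockCount N i))   ≡⟨ Σ<-cong r (λ i → Σ<-cong m (count-in-block i)) ⟩
    Σ< r (λ _ → Σ< m e)                  ≡⟨ Σ<-const r (Σ< m e) ⟩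
    r * Σ< m e                           ∎
    where open ≡-Reasoning

-- Powers as products, so that the ring solver can handle them.
square : ∀ x → x ^ 2 ≡ x * x
square x = cong (x *_) (*-identityʳ x)

cube : ∀ x → x ^ 3 ≡ x * x * x
cube x = trans (cong (λ z → x * (x * z)) (*-identityʳ x)) (sym (*-assoc x x x))

-- Outcome (i): a t × t submatrix N of M with w(N) ≥ 2c·t^{3/2}, where c = p/q.
DenseSquare : ∀ {n} → Matrix n n → ℕ → ℕ → ℕ → Set
DenseSquare M p q t = Σ[ N ∈ Matrix t t ] (Contains M N × 4 * p ^ 2 * t ^ 3 ≤ (w N * q) ^ 2)

-- Outcome (ii): an r-balanced (r·t) × m submatrix N of M with w(N) ≥ rs·√m·(r·t).
WideBalanced : ∀ {n} → Matrix n n → ℕ → ℕ → ℕ → Set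
WideBalanced M r s t = Σ[ m ∈ ℕ ] Σ[ N ∈ Matrix (r * t) m ]
  (1 ≤ m × Contains M N × Balanced r N × (r * s) ^ 2 * m * (r * t) ^ 2 ≤ w N ^ 2)

empty-dense : ∀ {n} (M : Matrix n n) p q → DenseSquare M p q 0
empty-dense M p q =
  (λ ()) , ((λ ()) , (λ ()) , (λ ()) , (λ ()) , (λ ())) , ≤-trans (≤-reflexive (*-zeroʳ (4 * p ^ 2))) z≤n

dense-from-√ : ∀ p q t W → (2 * p) √ (t * t * t) ≤ q * W → 4 * p ^ 2 * t ^ 3 ≤ (W * q) ^ 2
dense-from-√ p q t W h rewrite square p | cube t | square (W * q) =
  subst₂ _≤_ (coefficient p t) (*-comm-square q W) h
  where
  coefficient : ∀ p t → (2 * p) * (2 * p) * (t * t * t) ≡ 4 * (p * p) * (t * t * t)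
  coefficient = solve-∀
  *-comm-square : ∀ q W → (q * W) * (q * W) ≡ (W * q) * (W * q)
  *-comm-square = solve-∀

dense-or-sparse : ∀ {k t} (M : Matrix (k * t) (k * t)) p q → t ≤ k * t → (I : Fin k) (P : Fin (k * t) → Bool) →
  (∀ c → P c ≡ true → (2 * p) √ t ≤ q * blockCount M I c) →
  DenseSquare M p q t ⊎ q * Σ< (k * t) (λ c → keepIf (P c) (blockCount M I c)) ≤ (2 * p) √ (t * t * t)
dense-or-sparse {k} {t} M p q t≤n I P marked-dense with select (k * t) t t≤n P (blockCount M I)
... | (g , g-inc) , selected = conclude selected
  where
  d = blockCount M I
  N : Matrix t t
  N l j = M (combine I l) (g j)
  contained : Contains M N
  contained = combine I , g , combine-monoʳ-< I , g-inc , (λ _ _ h → h)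
  w-N : w N ≡ Σ< t (d ∘ g)
  w-N = Σ<-swap t t (λ l j → bit (M (combine I l) (g j)))
  regroup : ∀ p t → (t * (2 * p)) * (t * (2 * p)) * t ≡ (2 * p) * (2 * p) * (t * t * t)
  regroup = solve-∀
  conclude : (∀ j → P (g j) ≡ true) ⊎ Σ< (k * t) (λ c → keepIf (P c) (d c)) ≤ Σ< t (d ∘ g) →
    DenseSquare M p q t ⊎ q * Σ< (k * t) (λ c → keepIf (P c) (d c)) ≤ (2 * p) √ (t * t * t)
  conclude (inj₁ all-marked) = inj₁ (N , contained , dense-from-√ p q t (w N)
    (subst₂ _≤_ (regroup p t) (cong (λ z → z * z) (sym (trans (cong (q *_) w-N) (Σ<-*ˡ t q (d ∘ g)))))
            (Σ<-√-lower t (λ j → q * d (g j)) (λ j → marked-dense (g j) (all-marked j)))))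
  conclude (inj₂ heavy) with (2 * p) * (2 * p) * (t * t * t) ≤? (q * w N) * (q * w N)
  ... | yes dense = inj₁ (N , contained , dense-from-√ p q t (w N) dense)
  ... | no sparse = inj₂ (≤-trans (*-mono-≤ q·marked≤q·wN q·marked≤q·wN) (<⇒≤ (≰⇒> sparse)))
    where
    q·marked≤q·wN : q * Σ< (k * t) (λ c → keepIf (P c) (d c)) ≤ q * w N
    q·marked≤q·wN = *-monoʳ-≤ q (≤-trans heavy (≤-reflexive (sym w-N)))

maxOver : ∀ k → (Fin k → ℕ) → ℕ
maxOver zero    y = 0
maxOver (suc k) y = y zero ⊔ maxOver k (y ∘ suc)

≤maxOver : ∀ k y I → y I ≤ maxOver k y
≤maxOver (suc k) y zero    = m≤m⊔n _ _
≤maxOver (suc k) y (suc I) = ≤-trans (≤maxOver k (y ∘ suc) I) (m≤n⊔m _ _)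

-- The maximum is one of the values or 0, so it shares any property they all have.
maxOver-inherits : ∀ (Q : ℕ → Set) k y → Q 0 → (∀ I → Q (y I)) → Q (maxOver k y)
maxOver-inherits Q zero    y q0 qy = q0
maxOver-inherits Q (suc k) y q0 qy with ⊔-sel (y zero) (maxOver k (y ∘ suc))
... | inj₁ max≡y₀   = subst Q (sym max≡y₀) (qy zero)
... | inj₂ max≡rest = subst Q (sym max≡rest) (maxOver-inherits Q k (y ∘ suc) q0 (qy ∘ suc))

first-or-all : ∀ k {A : Set} {B : Fin k → Set} → (∀ I → A ⊎ B I) → A ⊎ (∀ I → B I)
first-or-all zero    h = inj₂ (λ ())
first-or-all (suc k) {B = B} h with h zero | first-or-all k {B = B ∘ suc} (h ∘ suc)
... | inj₁ a  | _        = inj₁ a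
... | inj₂ b₀ | inj₁ a   = inj₁ a
... | inj₂ b₀ | inj₂ all = inj₂ λ { zero → b₀ ; (suc I) → all I }

-- Step (2) in numbers, with u = 16r, k = u², everything multiplied by q: if the
-- scaled weight a satisfies a ≥ p·u³·√T and a ≤ b + (r-1)·y + k·(q·g), where
-- the big-entry weight b and the peak sum y are at most k·2p·√T, and if
-- g ≤ K·V and 8rsKq ≤ p, then V ≥ 112·r²·s·√T.
counting-arithmetic : ∀ r' s p q k K V a b y g T → let r = suc r' ; u = 16 * r in
  k ≡ u * u → (p * u * u * u) √ T ≤ a →
  b ≤ (k * (2 * p)) √ T → y ≤ (k * (2 * p)) √ T → a ≤ b + r' * y + k * (q * g) →
  g ≤ K * V → 8 * r * s * K * q ≤ p → 1 ≤ K → 1 ≤ q →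
  (112 * r * r * s) √ T ≤ V
counting-arithmetic r' s p q k K V a b y g T refl a-large b-small y-small a-split g≤KV density K≥1 q≥1 =
  √-cancel {q * K} {V} {112 * r * r * s} {T} (*-mono-≤ q≥1 K≥1)
    (√-weaken {q * K * (112 * r * r * s)} {14 * r * p} {q * g} {q * K * V} {T} ratio qg≤qKV qg-large)
  where
  r = suc r'
  u = 16 * r
  L = u * u * (2 * p)
  p·u³ : ∀ r' p → let u = 16 * suc r' in p * u * u * u ≡ (u * u * (2 * p) + r' * (u * u * (2 * p))) + u * u * (14 * suc r' * p)
  p·u³ = solve-∀
  small-part : b + r' * y ≤ (L + r' * L) √ T
  small-part = √-+-upper {b} {r' * y} {L} {r' * L} {T} b-small (√-scale r' {y} {L} {T} y-small)
  qg-large : (14 * r * p) √ T ≤ q * g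
  qg-large = √-cancel {u * u} {q * g} {14 * r * p} {T} (*-mono-≤ {1} {u} {1} {u} (s≤s z≤n) (s≤s z≤n))
    (√-∸ {a} {b + r' * y} {u * u * (q * g)} {L + r' * L} {u * u * (14 * r * p)} {T}
         (subst (λ z → z √ T ≤ a) (p·u³ r' p) a-large) a-split small-part)
  ratio-≡ : ∀ r s K q → 14 * r * (8 * r * s * K * q) ≡ q * K * (112 * r * r * s)
  ratio-≡ = solve-∀
  ratio : q * K * (112 * r * r * s) ≤ 14 * r * p
  ratio = subst (_≤ 14 * r * p) (ratio-≡ r s K q) (*-monoʳ-≤ (14 * r) density)
  qg≤qKV : q * g ≤ q * K * V
  qg≤qKV = subst (q * g ≤_) (sym (*-assoc q K V)) (*-monoʳ-≤ q g≤KV)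

k-as-square : ∀ r k → k ≡ 2 ^ 8 * r ^ 2 → k ≡ (16 * r) * (16 * r)
k-as-square r k hk = trans hk (trans (cong (256 *_) (square r)) (256r² r))
  where
  256r² : ∀ r → 256 * (r * r) ≡ (16 * r) * (16 * r)
  256r² = solve-∀

density-as-√ : ∀ p q u t k W → k ≡ u * u → p ^ 2 * (k * t) ^ 3 ≤ (W * q) ^ 2 → (p * u * u * u) √ (t * t * t) ≤ q * W
density-as-√ p q u t k W refl h rewrite square p | cube (u * u * t) | square (W * q) =
  subst₂ _≤_ (regroup p u t) (*-comm-square W q) h
  where
  regroup : ∀ p u t → p * p * (u * u * t * (u * u * t) * (u * u * t)) ≡ (p * u * u * u) * (p * u * u * u) * (t * t * t)
  regroup = solve-∀
  *-comm-square : ∀ W q → (W * q) * (W * q) ≡ (q * W) * (q * W)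
  *-comm-square = solve-∀

wide-from-√ : ∀ r s t k V → k ≡ (16 * r) * (16 * r) → (112 * r * r * s) √ (t * t * t) ≤ V →
  (r * s) ^ 2 * (k * t) * (r * t) ^ 2 ≤ (r * V) ^ 2
wide-from-√ r s t k V refl h rewrite square (r * s) | square (r * t) | square (r * V) = begin
  X                                                          ≤⟨ m≤n*m X 49 ⟩
  49 * X                                                     ≡⟨ regroup r s t ⟩
  r * r * ((112 * r * r * s) * (112 * r * r * s) * (t * t * t)) ≤⟨ *-monoʳ-≤ (r * r) h ⟩
  r * r * (V * V)                                            ≡⟨ square-of-* r V ⟨
  (r * V) * (r * V)                                          ∎
  where
  open ≤-Reasoning
  X = (r * s) * (r * s) * ((16 * r) * (16 * r) * t) * ((r * t) * (r * t))
  regroup : ∀ r s t → 49 * ((r * s) * (r * s) * ((16 * r) * (16 * r) * t) * ((r * t) * (r * t)))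
                      ≡ r * r * ((112 * r * r * s) * (112 * r * r * s) * (t * t * t))
  regroup = solve-∀

module Construction (r' s p q k t : ℕ) (M : Matrix (k * t) (k * t)) where

  r n : ℕ
  r = suc r'
  n = k * t

  d : Fin k → Fin n → ℕ
  d = blockCount M

  -- (I , c) is big when q·d(I,c) ≥ (2p)√t, i.e. d(I,c) ≥ 2c√t.
  big : Fin k → Fin n → Bool
  big I c = (2 * p) * (2 * p) * t ≤ᵇ (q * d I c) * (q * d I c)

  small : Fin k → Fin n → ℕ
  small I c = dropIf (big I c) (d I c)

  bigWeight : Fin k → ℕ
  bigWeight I = Σ< n (λ c → keepIf (big I c) (d I c))

  peak : Fin n → ℕ
  peak c = maxOver k (λ I → small I c)

  commonWeight : Subset k r → ℕ
  commonWeight S = Σ< n (λ c → minOn (proj₁ S) (λ I → small I c) (peak c))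

  big-dense : ∀ I c → big I c ≡ true → (2 * p) √ t ≤ q * d I c
  big-dense I c big≡true = ≤ᵇ⇒≤ _ _ (subst T (sym big≡true) tt)

  small-sparse : ∀ I c → q * small I c ≤ (2 * p) √ t
  small-sparse I c with big I c | ≤ᵇ-reflects-≤ ((2 * p) * (2 * p) * t) ((q * d I c) * (q * d I c))
  ... | true  | _             rewrite *-zeroʳ q = z≤n
  ... | false | ofⁿ not-dense = <⇒≤ (≰⇒> not-dense)

  peak-sparse : ∀ c → q * peak c ≤ (2 * p) √ t
  peak-sparse c = maxOver-inherits (λ z → q * z ≤ (2 * p) √ t) k (λ I → small I c)
    (subst (λ z → z * z ≤ (2 * p) * (2 * p) * t) (sym (*-zeroʳ q)) z≤n) (λ I → small-sparse I c)

  block-dichotomy : t ≤ n → ∀ I → DenseSquare M p q t ⊎ q * bigWeight I ≤ (2 * p) √ (t * t * t)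
  block-dichotomy t≤n I = dense-or-sparse M p q t≤n I (big I) (big-dense I)

  weight-split : w M ≤ Σ< k bigWeight + (k * sum (map commonWeight (subsets k r)) + r' * Σ< n peak)
  weight-split = begin
    w M                                                    ≡⟨ w-by-blocks {k} M ⟩
    Σ< k (λ I → Σ< n (d I))                                ≡⟨ Σ<-cong k split-block ⟩
    Σ< k (λ I → bigWeight I + Σ< n (small I))              ≡⟨ Σ<-+ k bigWeight _ ⟩
    Σ< k bigWeight + Σ< k (λ I → Σ< n (small I))           ≡⟨ cong (Σ< k bigWeight +_) (Σ<-swap k n small) ⟩
    Σ< k bigWeight + Σ< n (λ c → Σ< k (λ I → small I c))   ≤⟨ +-monoʳ-≤ (Σ< k bigWeight) small-part ⟩
    Σ< k bigWeight + (k * sum (map commonWeight (subsets k r)) + r' * Σ< n peak) ∎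
    where
    open ≤-Reasoning
    split-block : ∀ I → Σ< n (d I) ≡ bigWeight I + Σ< n (small I)
    split-block I = trans (Σ<-cong n (λ c → sym (keepIf+dropIf (big I c) (d I c)))) (Σ<-+ n _ _)
    G : Fin n → ℕ
    G c = subsetMinSum k r (λ I → small I c) (peak c)
    small-part : Σ< n (λ c → Σ< k (λ I → small I c)) ≤ k * sum (map commonWeight (subsets k r)) + r' * Σ< n peak
    small-part = begin
      Σ< n (λ c → Σ< k (λ I → small I c))
        ≡⟨ Σ<-cong n (λ c → Σ<-cong k (λ I → sym (m≤n⇒m⊓n≡m (≤maxOver k (λ I → small I c) I)))) ⟩
      Σ< n (λ c → Σ< k (λ I → small I c ⊓ peak c))
        ≤⟨ Σ<-mono n (λ c → layer-cake k r' (λ I → small I c) (peak c)) ⟩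
      Σ< n (λ c → k * G c + r' * peak c)
        ≡⟨ Σ<-+ n _ _ ⟩
      Σ< n (λ c → k * G c) + Σ< n (λ c → r' * peak c)
        ≡⟨ cong₂ _+_ (sym (Σ<-*ˡ n k G)) (sym (Σ<-*ˡ n r' peak)) ⟩
      k * Σ< n G + r' * Σ< n peak
        ≡⟨ cong (λ z → k * z + r' * Σ< n peak) (Σ<-sum-swap n _ (subsets k r)) ⟩
      k * sum (map commonWeight (subsets k r)) + r' * Σ< n peak ∎

  balanced-from : (S : Subset k r) →
    Σ[ N ∈ Matrix (r * t) n ] (Contains M N × Balanced r N × w N ≡ r * commonWeight S)
  balanced-from S = balanced-submatrix M S (λ c → minOn (proj₁ S) (λ I → small I c) (peak c))
    (λ i c → ≤-trans (minOn≤member (proj₁ S) _ _ i) (dropIf≤ (big (proj₁ S i) c) _))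

  sparse-gives-balanced : k ≡ (16 * r) * (16 * r) → 1 ≤ t → 1 ≤ q → 8 * r * s * (k C r) * q ≤ p →
    p ^ 2 * n ^ 3 ≤ (w M * q) ^ 2 → (∀ I → q * bigWeight I ≤ (2 * p) √ (t * t * t)) → WideBalanced M r s t
  sparse-gives-balanced hk t≥1 q≥1 density hw sparse =
    let (N , contained , balanced , w-N) = balanced-from S
    in n , N , *-mono-≤ k≥1 t≥1 , contained , balanced ,
       subst (λ z → (r * s) ^ 2 * n * (r * t) ^ 2 ≤ z ^ 2) (sym w-N) (wide-from-√ r s t k (commonWeight S) hk V-large)
    where
    k≥1 : 1 ≤ k
    k≥1 = subst (1 ≤_) (sym hk) (*-mono-≤ {1} {16 * r} {1} {16 * r} (s≤s z≤n) (s≤s z≤n))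
    r≤k : r ≤ k
    r≤k = subst (r ≤_) (sym hk) (≤-trans (m≤n*m r 16) (m≤m*n (16 * r) (16 * r)))
    nonempty : 1 ≤ length (subsets k r)
    nonempty = subsets-nonempty r≤k
    S : Subset k r
    S = proj₁ (averaging commonWeight (subsets k r) nonempty)
    total = sum (map commonWeight (subsets k r))
    total≤KV : total ≤ (k C r) * commonWeight S
    total≤KV = subst (λ K → total ≤ K * commonWeight S) (length-subsets k r)
                     (proj₂ (averaging commonWeight (subsets k r) nonempty))
    big-total : q * Σ< k bigWeight ≤ (k * (2 * p)) √ (t * t * t)
    big-total = subst (_≤ (k * (2 * p)) √ (t * t * t)) (sym (Σ<-*ˡ k q bigWeight))
                      (Σ<-√-upper k (λ I → q * bigWeight I) sparse)
    regroup : ∀ k t p → (k * t * (2 * p)) * (k * t * (2 * p)) * t ≡ (k * (2 * p)) * (k * (2 * p)) * (t * t * t)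
    regroup = solve-∀
    peak-total : q * Σ< n peak ≤ (k * (2 * p)) √ (t * t * t)
    peak-total = subst₂ _≤_ (cong (λ z → z * z) (sym (Σ<-*ˡ n q peak))) (regroup k t p)
                        (Σ<-√-upper n (λ c → q * peak c) peak-sparse)
    distribute : ∀ q B k V r' P → q * (B + (k * V + r' * P)) ≡ q * B + r' * (q * P) + k * (q * V)
    distribute = solve-∀
    q·split : q * w M ≤ q * Σ< k bigWeight + r' * (q * Σ< n peak) + k * (q * total)
    q·split = ≤-trans (*-monoʳ-≤ q weight-split) (≤-reflexive (distribute q _ k total r' _))
    V-large : (112 * r * r * s) √ (t * t * t) ≤ commonWeight S
    V-large = counting-arithmetic r' s p q k (k C r) (commonWeight S) (q * w M) (q * Σ< k bigWeight)
      (q * Σ< n peak) total (t * t * t) hk (density-as-√ p q (16 * r) t k (w M) hk hw)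
      big-total peak-total q·split total≤KV density
      (subst (1 ≤_) (length-subsets k r) nonempty) q≥1

lemma5p4 : (r s p q : ℕ) → 1 ≤ r → 1 ≤ s → 1 ≤ q →
    (k : ℕ) → k ≡ 2 ^ 8 * r ^ 2 →
    8 * r * s * (k C r) * q ≤ p →
    (n t : ℕ) → n ≡ k * t → (M : Matrix n n) →
    p ^ 2 * n ^ 3 ≤ (w M * q) ^ 2 →
    (Σ[ N ∈ Matrix t t ] (Contains M N × 4 * p ^ 2 * t ^ 3 ≤ (w N * q) ^ 2))
    ⊎ (Σ[ m ∈ ℕ ] Σ[ N ∈ Matrix (r * t) m ]
         (1 ≤ m × Contains M N × Balanced r N ×
          (r * s) ^ 2 * m * (r * t) ^ 2 ≤ w N ^ 2))
lemma5p4 (suc r') s p q _ _ q≥1 k hk density _ zero    refl M hw = inj₁ (empty-dense M p q)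
lemma5p4 (suc r') s p q _ _ q≥1 k hk density _ (suc t) refl M hw =
  map₂ (sparse-gives-balanced k≡u² (s≤s z≤n) q≥1 density hw)
       (first-or-all k (block-dichotomy t≤n))
  where
  open Construction r' s p q k (suc t) M
  k≡u² : k ≡ (16 * suc r') * (16 * suc r')
  k≡u² = k-as-square (suc r') k hk
  t≤n : suc t ≤ k * suc t
  t≤n = subst (λ k → suc t ≤ k * suc t) (sym k≡u²) (m≤n*m (suc t) (16 * suc r' * (16 * suc r')))
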